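{- Let $d$ and $k$ be positive integers. Then for all sufficiently large $n$, $$ f(n,n-k,d,2) = n-2d-k+3. $$ That is, every graph on $n$ vertices with minimum degree at least $n-k$, in every coloring of its edges with two colors, contains a monochromatic subgraph with minimum degree at least $d$ on at least $n-2d-k+3$ vertices, and there is such a graph and coloring in which no monochromatic subgraph with minimum degree at least $d$ has more than $n-2d-k+3$ vertices.
   Context: All graphs are finite, simple and undirected. For a graph $G$ and positive integers $d,r$, $f_G(d,r)$ denotes the largest integer $t$ such that in every coloring of the edges of $G$ with $r$ colors there is a monochromatic subgraph (a subgraph all of whose edges have the same color) with minimum degree at least $d$ and order (number of vertices) at least $t$. For $n > k' > d$, $f(n,k',d,r)$ denotes the minimum of $f_G(d,r)$ over all graphs $G$ with $n$ vertices and minimum degree at least $k'$. -}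

module Defs where

open import Data.Nat using (ℕ; zero; suc; _+_; _∸_; _≤_; _≥_)
open import Data.Bool using (Bool; true; false; if_then_else_)
open import Data.Fin using (Fin; zero; suc)
open import Data.Product using (Σ; _×_; _,_; ∃-syntax)
open import Relation.Binary.PropositionalEquality using (_≡_)

countTrue : ∀ {n} → (Fin n → Bool) → ℕ
countTrue {zero} p = 0
countTrue {suc n} p = (if p zero then 1 else 0) + countTrue (λ i → p (suc i))

record Graph (n : ℕ) : Set where
  field
    adj   : Fin n → Fin n → Bool
    sym   : ∀ u v → adj u v ≡ adj v u
    irrfl : ∀ v → adj v v ≡ false
open Graph public

degree : ∀ {n} → Graph n → Fin n → ℕ
degree G v = countTrue (adj G v)

MinDegAtLeast : ∀ {n} → Graph n → ℕ → Set
MinDegAtLeast {n} G k = ∀ v → k ≤ degree G v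

-- An r-colouring of the edges of G: a colour for every (unordered) pair.
-- Only its values on edges of G matter.
Colouring : ℕ → ℕ → Set
Colouring n r = Fin n → Fin n → Fin r

SymColouring : ∀ {n r} → Colouring n r → Set
SymColouring {n} c = ∀ u v → c u v ≡ c v u

record Subgraph {n : ℕ} (G : Graph n) : Set where
  field
    S     : Fin n → Bool
    E     : Fin n → Fin n → Bool
    Esym  : ∀ u v → E u v ≡ E v u
    E⊆G   : ∀ u v → E u v ≡ true → adj G u v ≡ true
    E⊆S   : ∀ u v → E u v ≡ true → S u ≡ true
open Subgraph public

order : ∀ {n} {G : Graph n} → Subgraph G → ℕ
order H = countTrue (S H)

SubMinDeg : ∀ {n} {G : Graph n} → Subgraph G → ℕ → Set
SubMinDeg H d = ∀ v → S H v ≡ true → d ≤ countTrue (E H v)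

Mono : ∀ {n r} {G : Graph n} → Colouring n r → Fin r → Subgraph G → Set
Mono c i H = ∀ u v → E H u v ≡ true → c u v ≡ i

HasMonoSub : ∀ {n r} (G : Graph n) → Colouring n r → (d t : ℕ) → Set
HasMonoSub {n} {r} G c d t =
  Σ (Fin r) λ i → Σ (Subgraph G) λ H → Mono c i H × SubMinDeg H d × t ≤ order H

-- f(n,k',d,r) = m  (as the minimum over G of the largest such t):
--  * every G on n vertices with δ(G) ≥ k' and every r-colouring has such a subgraph of order ≥ m
--  * some G with δ(G) ≥ k' and some colouring has all such subgraphs of order ≤ m
fEquals : (n k' d r m : ℕ) → Set
fEquals n k' d r m =
  ((G : Graph n) → MinDegAtLeast G k' → (c : Colouring n r) → SymColouring c →
     HasMonoSub G c d m)
  × (Σ (Graph n) λ G → MinDegAtLeast G k' × Σ (Colouring n r) λ c → SymColouring c ×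
     ((i : Fin r) (H : Subgraph G) → Mono c i H → SubMinDeg H d → order H ≤ m))

-- Write d = d′ + 1, k = k′ + 1 and s = 2d′ + k′, so that n + 3 − (2d + k) = n − s.
--
-- Lower bound: in each colour, greedily delete vertices of degree < d in that colour.  If one of
-- the two processes stops within s deletions, the at least n − s surviving vertices carry a
-- monochromatic subgraph of minimum degree d.  Otherwise let A (red) and B (blue) be the first
-- s + 1 deleted vertices: every a ∈ A has fewer than d red neighbours outside A, and dually for B.
-- A vertex of A ∩ B would have degree < 2(d + s + 1) ≤ n − k, so A and B are disjoint.  Then every
-- a ∈ A has at least d blue neighbours in B (it misses at most k′ vertices of B and has at most d′
-- red neighbours there), while every b ∈ B has at most d′ blue neighbours in A; counting the blue
-- edges between A and B both ways gives (s + 1) d ≤ (s + 1) d′.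
--
-- Upper bound: split the vertices into A = [0, s), B = [s, 2s) and the rest C.  Edges inside A and
-- between A and C are blue, the other edges outside A × B are red, and an edge between x ∈ A and
-- s + y ∈ B gets the label (x + y) mod s: it is red below d′, blue below 2d′ and absent otherwise.
-- Every vertex misses at most k′ others, vertices of A have only d′ red and vertices of B only d′
-- blue neighbours, so a red (blue) subgraph of minimum degree d avoids A (B).

module Submission where

open import Defs hiding (sym)
open import Data.Nat hiding (_≟_)
open import Data.Nat.Properties hiding (_≟_; suc-injective)
open import Data.Nat.Tactic.RingSolver using (solve-∀)
open import Algebra.Properties.CommutativeMonoid.Sum +-0-commutativeMonoid using (sum; sum-cong-≗; ∑-comm)
open import Data.Bool using (Bool; true; false; if_then_else_; not; _∧_; _∨_; T)
import Data.Bool as Bool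
open import Data.Bool.Properties using (∨-identityʳ; ∧-zeroʳ; ∨-conicalʳ; not-involutive)
open import Data.Fin using (Fin; zero; suc; toℕ; _≟_)
open import Data.Fin.Properties using (toℕ-injective; suc-injective; any?)
open import Data.Product using (Σ; _×_; _,_; proj₁; proj₂)
open import Data.Sum using (_⊎_; inj₁; inj₂)
open import Data.Empty using (⊥; ⊥-elim)
open import Function using (_∘_; flip)
open import Relation.Binary.PropositionalEquality
open import Relation.Nullary using (yes; no; does; _×-dec_)
open import Relation.Nullary.Decidable using (dec-true)

variable
  n : ℕ

-- Vertex sets as Boolean predicates

infix 4 _∈_ _∉_ _⊆_
infixr 7 _∩_
infixr 6 _∪_

_∈_ _∉_ : Fin n → (Fin n → Bool) → Set
v ∈ p = p v ≡ true
v ∉ p = p v ≡ false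

_⊆_ : (p q : Fin n → Bool) → Set
p ⊆ q = ∀ i → i ∈ p → i ∈ q

∅ : Fin n → Bool
∅ _ = false

｛_｝ : Fin n → Fin n → Bool
｛ v ｝ w = does (w ≟ v)

∁ : (Fin n → Bool) → Fin n → Bool
∁ p i = not (p i)

_∩_ _∪_ : (p q : Fin n → Bool) → Fin n → Bool
(p ∩ q) i = p i ∧ q i
(p ∪ q) i = p i ∨ q i

true≢false : ∀ {b} → b ≡ true → b ≡ false → ⊥
true≢false e f with () ← trans (sym e) f

not-true⁻ : ∀ {a} → not a ≡ true → a ≡ false
not-true⁻ {false} _ = refl

∧-true⁻ˡ : ∀ {a b} → a ∧ b ≡ true → a ≡ true
∧-true⁻ˡ {true} _ = refl

∧-true⁻ʳ : ∀ {a b} → a ∧ b ≡ true → b ≡ true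
∧-true⁻ʳ {true} e = e

∧-true⁺ : ∀ {a b} → a ≡ true → b ≡ true → a ∧ b ≡ true
∧-true⁺ refl refl = refl

∨-true⁻ : ∀ {a b} → a ∨ b ≡ true → a ≡ true ⊎ b ≡ true
∨-true⁻ {true} _ = inj₁ refl
∨-true⁻ {false} e = inj₂ e

∧-swapˡ : ∀ a b c → a ∧ (b ∧ c) ≡ b ∧ (a ∧ c)
∧-swapˡ true b c = refl
∧-swapˡ false b c = sym (∧-zeroʳ b)

⊆∁-sym : ∀ {A B : Fin n → Bool} → B ⊆ ∁ A → A ⊆ ∁ B
⊆∁-sym {B = B} B⊆∁A v v∈A with B v in v∈B
... | false = refl
... | true  = ⊥-elim (true≢false v∈A (not-true⁻ (B⊆∁A v v∈B)))

≟-true : ∀ {r} {x y : Fin r} → does (x ≟ y) ≡ true → x ≡ y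
≟-true {x = x} {y} e with x ≟ y | e
... | yes x≡y | _ = x≡y

≟-sym : ∀ {r} (x y : Fin r) → does (x ≟ y) ≡ does (y ≟ x)
≟-sym x y with x ≟ y | y ≟ x
... | yes _   | yes _   = refl
... | no  _   | no  _   = refl
... | yes x≡y | no  y≢x = ⊥-elim (y≢x (sym x≡y))
... | no  x≢y | yes y≡x = ⊥-elim (x≢y (sym y≡x))


T⇒≡true : ∀ {b} → T b → b ≡ true
T⇒≡true {true} _ = refl

≡true⇒T : ∀ {b} → b ≡ true → T b
≡true⇒T refl = _

<ᵇ-true⇒< : ∀ {x y} → (x <ᵇ y) ≡ true → x < y
<ᵇ-true⇒< {x} {y} e = <ᵇ⇒< x y (≡true⇒T e)

<ᵇ-false⁺ : ∀ {x y} → y ≤ x → (x <ᵇ y) ≡ false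
<ᵇ-false⁺ {x} {y} y≤x with x <ᵇ y in x<y
... | false = refl
... | true  = ⊥-elim (<⇒≱ (<ᵇ⇒< x y (≡true⇒T x<y)) y≤x)

<ᵇ-false⇒≥ : ∀ {x y} → (x <ᵇ y) ≡ false → y ≤ x
<ᵇ-false⇒≥ e = ≮⇒≥ (λ x<y → true≢false (T⇒≡true (<⇒<ᵇ x<y)) e)

≤ᵇ-true⇒≤ : ∀ {x y} → (x ≤ᵇ y) ≡ true → x ≤ y
≤ᵇ-true⇒≤ {x} {y} e = ≤ᵇ⇒≤ x y (≡true⇒T e)

≤ᵇ-false⇒> : ∀ {x y} → (x ≤ᵇ y) ≡ false → y < x
≤ᵇ-false⇒> e = ≰⇒> (λ x≤y → true≢false (T⇒≡true (≤⇒≤ᵇ x≤y)) e)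

-- Counting

countTrue-cong : ∀ {p q : Fin n → Bool} → (∀ i → p i ≡ q i) → countTrue p ≡ countTrue q
countTrue-cong {zero} eq = refl
countTrue-cong {suc n} eq = cong₂ _+_ (cong (λ b → if b then 1 else 0) (eq zero)) (countTrue-cong (eq ∘ suc))

countTrue-none : ∀ (p : Fin n → Bool) → (∀ i → i ∉ p) → countTrue p ≡ 0
countTrue-none {zero} p none = refl
countTrue-none {suc n} p none rewrite none zero = countTrue-none (p ∘ suc) (none ∘ suc)

countTrue-mono : ∀ {p q : Fin n → Bool} → p ⊆ q → countTrue p ≤ countTrue q
countTrue-mono {zero} p⊆q = z≤n
countTrue-mono {suc n} {p} {q} p⊆q with p zero in p₀ | q zero in q₀
... | true  | true  = s≤s (countTrue-mono (p⊆q ∘ suc))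
... | true  | false = ⊥-elim (true≢false (p⊆q zero p₀) q₀)
... | false | true  = m≤n⇒m≤1+n (countTrue-mono (p⊆q ∘ suc))
... | false | false = countTrue-mono (p⊆q ∘ suc)

countTrue-cover : ∀ {p q r : Fin n → Bool} → (∀ i → i ∈ p → i ∈ q ⊎ i ∈ r) →
  countTrue p ≤ countTrue q + countTrue r
countTrue-cover {zero} cover = z≤n
countTrue-cover {suc n} {p} {q} {r} cover with p zero in p₀ | q zero in q₀ | r zero in r₀
... | false | a     | b     = ≤-trans (countTrue-cover (cover ∘ suc))
                                (+-mono-≤ (m≤n+m _ (if a then 1 else 0)) (m≤n+m _ (if b then 1 else 0)))
... | true  | true  | b     = s≤s (≤-trans (countTrue-cover (cover ∘ suc))
                                (+-monoʳ-≤ (countTrue (q ∘ suc)) (m≤n+m _ (if b then 1 else 0))))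
... | true  | false | true  = ≤-trans (s≤s (countTrue-cover (cover ∘ suc))) (≤-reflexive (sym (+-suc _ _)))
... | true  | false | false with cover zero p₀
...   | inj₁ q₀≡true = ⊥-elim (true≢false q₀≡true q₀)
...   | inj₂ r₀≡true = ⊥-elim (true≢false r₀≡true r₀)

countTrue-cover₃ : ∀ {p q r t : Fin n → Bool} → (∀ i → i ∈ p → i ∈ q ⊎ i ∈ r ⊎ i ∈ t) →
  countTrue p ≤ countTrue q + (countTrue r + countTrue t)
countTrue-cover₃ {p = p} {q} {r} {t} cover =
  ≤-trans (countTrue-cover {r = p ∩ ∁ q} inQ⊎rest) (+-monoʳ-≤ (countTrue q) (countTrue-cover inR⊎T))
  where
  inQ⊎rest : ∀ i → i ∈ p → i ∈ q ⊎ i ∈ p ∩ ∁ q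
  inQ⊎rest i pᵢ with q i in qᵢ
  ... | true  = inj₁ refl
  ... | false = inj₂ (∧-true⁺ pᵢ refl)
  inR⊎T : ∀ i → i ∈ p ∩ ∁ q → i ∈ r ⊎ i ∈ t
  inR⊎T i e with cover i (∧-true⁻ˡ e)
  ... | inj₁ qᵢ = ⊥-elim (true≢false qᵢ (not-true⁻ (∧-true⁻ʳ {p i} e)))
  ... | inj₂ r⊎t = r⊎t

countTrue-∁ : ∀ (p : Fin n → Bool) → countTrue p + countTrue (∁ p) ≡ n
countTrue-∁ {zero} p = refl
countTrue-∁ {suc n} p with p zero
... | true  = cong suc (countTrue-∁ (p ∘ suc))
... | false = trans (+-suc _ _) (cong suc (countTrue-∁ (p ∘ suc)))

countTrue-∁≡∸ : ∀ (p : Fin n → Bool) → countTrue (∁ p) ≡ n ∸ countTrue p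
countTrue-∁≡∸ p = sym (trans (cong (_∸ countTrue p) (sym (countTrue-∁ p))) (m+n∸m≡n (countTrue p) _))

countTrue∁≤⇒≤countTrue : ∀ (p : Fin n → Bool) {k} → countTrue (∁ p) ≤ k → n ∸ k ≤ countTrue p
countTrue∁≤⇒≤countTrue {n} p {k} ∁p≤k = begin
  n ∸ k                                           ≤⟨ ∸-monoʳ-≤ n ∁p≤k ⟩
  n ∸ countTrue (∁ p)                             ≡⟨ cong (_∸ countTrue (∁ p)) (sym (countTrue-∁ p)) ⟩
  countTrue p + countTrue (∁ p) ∸ countTrue (∁ p) ≡⟨ m+n∸n≡m (countTrue p) (countTrue (∁ p)) ⟩
  countTrue p                                     ∎
  where open ≤-Reasoning

≤countTrue⇒countTrue∁≤ : ∀ (p : Fin n → Bool) {k} → n ∸ k ≤ countTrue p → countTrue (∁ p) ≤ k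
≤countTrue⇒countTrue∁≤ {n} p {k} n∸k≤p = +-cancelˡ-≤ (countTrue p) _ _ (begin
  countTrue p + countTrue (∁ p) ≡⟨ countTrue-∁ p ⟩
  n                             ≤⟨ m≤n+m∸n n k ⟩
  k + (n ∸ k)                   ≤⟨ +-monoʳ-≤ k n∸k≤p ⟩
  k + countTrue p               ≡⟨ +-comm k _ ⟩
  countTrue p + k               ∎)
  where open ≤-Reasoning

countTrue-interval : ∀ {p : Fin n → Bool} lo hi → hi ≤ n →
  (∀ v → lo ≤ toℕ v → toℕ v < hi → v ∈ p) → hi ∸ lo ≤ countTrue p
countTrue-interval {zero} lo zero _ _ = ≤-reflexive (0∸n≡0 lo)
countTrue-interval {suc n} lo zero _ _ = ≤-trans (≤-reflexive (0∸n≡0 lo)) z≤n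
countTrue-interval {suc n} zero (suc hi) (s≤s hi≤n) inside rewrite inside zero z≤n (s≤s z≤n) =
  s≤s (countTrue-interval zero hi hi≤n (λ v _ v<hi → inside (suc v) z≤n (s≤s v<hi)))
countTrue-interval {suc n} (suc lo) (suc hi) (s≤s hi≤n) inside =
  ≤-trans (countTrue-interval lo hi hi≤n (λ v lo≤v v<hi → inside (suc v) (s≤s lo≤v) (s≤s v<hi))) (m≤n+m _ _)

countTrue-insert : ∀ (p : Fin n → Bool) {v} → v ∉ p → countTrue (p ∪ ｛ v ｝) ≡ suc (countTrue p)
countTrue-insert {suc n} p {zero} v∉p rewrite v∉p =
  cong suc (countTrue-cong (λ i → ∨-identityʳ (p (suc i))))
countTrue-insert {suc n} p {suc v} v∉p rewrite ∨-identityʳ (p zero) =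
  trans (cong (_ +_) (countTrue-insert (p ∘ suc) v∉p)) (+-suc _ _)

countTrue-≤1 : ∀ {p : Fin n → Bool} → (∀ i j → i ∈ p → j ∈ p → i ≡ j) → countTrue p ≤ 1
countTrue-≤1 {zero} unique = z≤n
countTrue-≤1 {suc n} {p} unique with p zero in p₀
... | true  = ≤-reflexive (cong suc (countTrue-none (p ∘ suc) rest))
  where
  rest : ∀ i → p (suc i) ≡ false
  rest i with p (suc i) in pᵢ
  ... | false = refl
  ... | true with () ← unique zero (suc i) p₀ pᵢ
... | false = countTrue-≤1 (λ i j pi pj → suc-injective (unique (suc i) (suc j) pi pj))

Injective-on : (Fin n → Bool) → (Fin n → ℕ) → Set
Injective-on p f = ∀ i j → i ∈ p → j ∈ p → f i ≡ f j → i ≡ j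

countTrue-injective-< : ∀ {p : Fin n → Bool} (f : Fin n → ℕ) → Injective-on p f → ∀ U →
  (∀ i → i ∈ p → f i < U) → countTrue p ≤ U
countTrue-injective-< {p = p} f inj zero below = ≤-reflexive (countTrue-none p none)
  where
  none : ∀ i → i ∉ p
  none i with p i in pᵢ
  ... | false = refl
  ... | true with () ← below i pᵢ
countTrue-injective-< {p = p} f inj (suc U) below = begin
  countTrue p                   ≤⟨ countTrue-cover split ⟩
  countTrue low + countTrue top ≤⟨ +-mono-≤ (countTrue-injective-< f lowInjective U lowBelow) (countTrue-≤1 topUnique) ⟩
  U + 1                         ≡⟨ +-comm U 1 ⟩
  suc U                         ∎
  where
  open ≤-Reasoning
  low top : Fin _ → Bool
  low = p ∩ (λ i → f i <ᵇ U)
  top = p ∩ (λ i → f i ≡ᵇ U)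
  split : ∀ i → i ∈ p → i ∈ low ⊎ i ∈ top
  split i pᵢ with m≤n⇒m<n∨m≡n (≤-pred (below i pᵢ))
  ... | inj₁ fᵢ<U = inj₁ (∧-true⁺ pᵢ (T⇒≡true (<⇒<ᵇ fᵢ<U)))
  ... | inj₂ fᵢ≡U = inj₂ (∧-true⁺ pᵢ (T⇒≡true (≡⇒≡ᵇ _ _ fᵢ≡U)))
  lowInjective : Injective-on low f
  lowInjective i j lᵢ lⱼ = inj i j (∧-true⁻ˡ lᵢ) (∧-true⁻ˡ lⱼ)
  lowBelow : ∀ i → i ∈ low → f i < U
  lowBelow i e = <ᵇ-true⇒< (∧-true⁻ʳ e)
  topValue : ∀ i → i ∈ top → f i ≡ U
  topValue i e = ≡ᵇ⇒≡ _ _ (≡true⇒T (∧-true⁻ʳ e))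
  topUnique : ∀ i j → i ∈ top → j ∈ top → i ≡ j
  topUnique i j tᵢ tⱼ =
    inj i j (∧-true⁻ˡ tᵢ) (∧-true⁻ˡ tⱼ) (trans (topValue i tᵢ) (sym (topValue j tⱼ)))

countTrue-injective : ∀ {p : Fin n → Bool} (f : Fin n → ℕ) → Injective-on p f → ∀ L U →
  (∀ i → i ∈ p → L ≤ f i × f i < U) → countTrue p ≤ U ∸ L
countTrue-injective f inj L U range = countTrue-injective-< (λ i → f i ∸ L) inj′ (U ∸ L)
  (λ i pᵢ → ∸-monoˡ-< (proj₂ (range i pᵢ)) (proj₁ (range i pᵢ)))
  where
  inj′ : Injective-on _ (λ i → f i ∸ L)
  inj′ i j pᵢ pⱼ eq = inj i j pᵢ pⱼ (∸-cancelʳ-≡ (proj₁ (range i pᵢ)) (proj₁ (range j pⱼ)) eq)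

-- Double counting

sum-mono-≤ : ∀ {f g : Fin n → ℕ} → (∀ i → f i ≤ g i) → sum f ≤ sum g
sum-mono-≤ {zero} f≤g = z≤n
sum-mono-≤ {suc n} f≤g = +-mono-≤ (f≤g zero) (sum-mono-≤ (f≤g ∘ suc))

countTrue≡sum : ∀ (p : Fin n → Bool) → countTrue p ≡ sum (λ i → if p i then 1 else 0)
countTrue≡sum {zero} p = refl
countTrue≡sum {suc n} p = cong ((if p zero then 1 else 0) +_) (countTrue≡sum (p ∘ suc))

countTrue-guard : ∀ b (q : Fin n → Bool) → countTrue (λ j → b ∧ q j) ≡ (if b then countTrue q else 0)
countTrue-guard true q = refl
countTrue-guard {n} false q = countTrue-none {n} _ (λ _ → refl)

sum-guard-const : ∀ (p : Fin n → Bool) x → sum (λ i → if p i then x else 0) ≡ countTrue p * x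
sum-guard-const {zero} p x = refl
sum-guard-const {suc n} p x with p zero
... | true  = cong (x +_) (sum-guard-const (p ∘ suc) x)
... | false = sum-guard-const (p ∘ suc) x

sum-guard-≥ : ∀ (p : Fin n → Bool) (g : Fin n → ℕ) x → (∀ i → i ∈ p → x ≤ g i) →
  countTrue p * x ≤ sum (λ i → if p i then g i else 0)
sum-guard-≥ p g x below = subst (_≤ _) (sum-guard-const p x) (sum-mono-≤ pointwise)
  where
  pointwise : ∀ i → (if p i then x else 0) ≤ (if p i then g i else 0)
  pointwise i with p i in pᵢ
  ... | true  = below i pᵢ
  ... | false = z≤n

sum-guard-≤ : ∀ (p : Fin n → Bool) (g : Fin n → ℕ) y → (∀ i → i ∈ p → g i ≤ y) →
  sum (λ i → if p i then g i else 0) ≤ countTrue p * y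
sum-guard-≤ p g y above = subst (_ ≤_) (sum-guard-const p y) (sum-mono-≤ pointwise)
  where
  pointwise : ∀ i → (if p i then g i else 0) ≤ (if p i then y else 0)
  pointwise i with p i in pᵢ
  ... | true  = above i pᵢ
  ... | false = z≤n

double-counting : ∀ {m} (A : Fin m → Bool) (B : Fin n → Bool) (R : Fin m → Fin n → Bool) x y →
  (∀ a → a ∈ A → x ≤ countTrue (B ∩ R a)) →
  (∀ b → b ∈ B → countTrue (A ∩ flip R b) ≤ y) →
  countTrue A * x ≤ countTrue B * y
double-counting A B R x y fromA fromB = begin
  countTrue A * x
    ≤⟨ sum-guard-≥ A _ x fromA ⟩
  sum (λ a → if A a then countTrue (B ∩ R a) else 0)
    ≡⟨ sum-cong-≗ (λ a → sym (countTrue-guard (A a) (B ∩ R a))) ⟩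
  sum (λ a → countTrue (λ b → A a ∧ (B b ∧ R a b)))
    ≡⟨ sum-cong-≗ (λ a → countTrue≡sum (λ b → A a ∧ (B b ∧ R a b))) ⟩
  sum (λ a → sum (λ b → if A a ∧ (B b ∧ R a b) then 1 else 0))
    ≡⟨ ∑-comm (λ a b → if A a ∧ (B b ∧ R a b) then 1 else 0) ⟩
  sum (λ b → sum (λ a → if A a ∧ (B b ∧ R a b) then 1 else 0))
    ≡⟨ sum-cong-≗ (λ b → sym (countTrue≡sum (λ a → A a ∧ (B b ∧ R a b)))) ⟩
  sum (λ b → countTrue (λ a → A a ∧ (B b ∧ R a b)))
    ≡⟨ sum-cong-≗ (λ b → trans (countTrue-cong (λ a → ∧-swapˡ (A a) (B b) (R a b)))
                              (countTrue-guard (B b) (A ∩ flip R b))) ⟩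
  sum (λ b → if B b then countTrue (A ∩ flip R b) else 0)
    ≤⟨ sum-guard-≤ B _ y fromB ⟩
  countTrue B * y ∎
  where open ≤-Reasoning

module Peeling (R : Fin n → Fin n → Bool) (d : ℕ) where

  degreeIn : (Fin n → Bool) → Fin n → ℕ
  degreeIn S v = countTrue (S ∩ R v)

  degreeIn-mono : ∀ {S T} v → S ⊆ T → degreeIn S v ≤ degreeIn T v
  degreeIn-mono v S⊆T = countTrue-mono (λ w e → ∧-true⁺ (S⊆T w (∧-true⁻ˡ e)) (∧-true⁻ʳ e))

  Core : ℕ → Set
  Core t = Σ (Fin n → Bool) λ S → t ≤ countTrue S × (∀ v → v ∈ S → d ≤ degreeIn S v)

  -- The sets of vertices deleted by greedily removing vertices of degree < d: each a ∈ A had fewer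
  -- than d neighbours among the vertices still present when it was removed, and these include ∁ A.
  Peelable : (Fin n → Bool) → Set
  Peelable A = ∀ a → a ∈ A → degreeIn (∁ A) a < d

  peelable-insert : ∀ {A} v → degreeIn (∁ A) v < d → Peelable A → Peelable (A ∪ ｛ v ｝)
  peelable-insert {A} v low peelable a a∈A′ =
    ≤-trans (s≤s (degreeIn-mono a ∁A′⊆∁A)) (lowDegree (∨-true⁻ a∈A′))
    where
    ∁A′⊆∁A : ∁ (A ∪ ｛ v ｝) ⊆ ∁ A
    ∁A′⊆∁A w e with A w
    ... | false = refl
    lowDegree : a ∈ A ⊎ a ∈ ｛ v ｝ → degreeIn (∁ A) a < d
    lowDegree (inj₁ a∈A) = peelable a a∈A
    lowDegree (inj₂ a∈｛v｝) = subst (λ u → degreeIn (∁ A) u < d) (sym (≟-true a∈｛v｝)) low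

  core-weaken : ∀ {t t′} → t ≤ t′ → Core t′ → Core t
  core-weaken t≤t′ (S , big , dense) = S , ≤-trans t≤t′ big , dense

  PeelOutcome : ℕ → Set
  PeelOutcome j = Core (n ∸ j) ⊎ Σ (Fin n → Bool) λ A → countTrue A ≡ suc j × Peelable A

  peel-step : ∀ {A} → Peelable A → PeelOutcome (countTrue A)
  peel-step {A} peelable with any? (λ v → (A v Bool.≟ false) ×-dec (degreeIn (∁ A) v <? d))
  ... | yes (v , v∉A , low) = inj₂ (A ∪ ｛ v ｝ , countTrue-insert A v∉A , peelable-insert v low peelable)
  ... | no stuck = inj₁ (∁ A , ≤-reflexive (sym (countTrue-∁≡∸ A)) , dense)
    where
    dense : ∀ v → v ∈ ∁ A → d ≤ degreeIn (∁ A) v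
    dense v v∈∁A = ≮⇒≥ (λ low → stuck (v , not-true⁻ v∈∁A , low))

  peel : ∀ j → PeelOutcome j
  peel zero = subst PeelOutcome (countTrue-none {n} ∅ (λ _ → refl)) (peel-step {∅} (λ a ()))
  peel (suc j) with peel j
  ... | inj₁ core = inj₁ (core-weaken (∸-monoʳ-≤ n (n≤1+n j)) core)
  ... | inj₂ (A , |A| , peelable) with peel-step peelable
  ...   | inj₁ core = inj₁ (subst (λ t → Core (n ∸ t)) |A| core)
  ...   | inj₂ (A′ , |A′| , peelable′) = inj₂ (A′ , trans |A′| (cong suc |A|) , peelable′)

  peelable-degree : ∀ {A} → Peelable A → ∀ a → a ∈ A → countTrue (R a) < d + countTrue A
  peelable-degree {A} peelable a a∈A = begin-strict
    countTrue (R a)                ≤⟨ countTrue-cover split ⟩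
    degreeIn (∁ A) a + countTrue A <⟨ +-monoˡ-< (countTrue A) (peelable a a∈A) ⟩
    d + countTrue A                ∎
    where
    open ≤-Reasoning
    split : ∀ w → w ∈ R a → w ∈ ∁ A ∩ R a ⊎ w ∈ A
    split w e with A w in w∈A
    ... | true  = inj₂ refl
    ... | false = inj₁ e

  peelable-degreeIn : ∀ {A X} → Peelable A → ∀ a → a ∈ A → X ⊆ ∁ A → degreeIn X a < d
  peelable-degreeIn peelable a a∈A X⊆∁A = ≤-trans (s≤s (degreeIn-mono a X⊆∁A)) (peelable a a∈A)

module ColourClasses {r} (G : Graph n) (c : Colouring n r) where

  colourAdj : Fin r → Fin n → Fin n → Bool
  colourAdj i v w = adj G v w ∧ does (c v w ≟ i)

  colourAdj-sym : SymColouring c → ∀ i v w → colourAdj i v w ≡ colourAdj i w v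
  colourAdj-sym csym i v w rewrite Graph.sym G v w | csym v w = refl

  open Peeling using (Core; degreeIn)

  core⇒monoSub : SymColouring c → ∀ i {d t} → Core (colourAdj i) d t → HasMonoSub G c d t
  core⇒monoSub csym i {d} (S , big , dense) = i , H , mono , minDeg , big
    where
    H : Subgraph G
    H = record
      { S    = S
      ; E    = λ u w → S u ∧ (S w ∧ colourAdj i u w)
      ; Esym = E-sym
      ; E⊆G  = λ u w e → ∧-true⁻ˡ (∧-true⁻ʳ {S w} (∧-true⁻ʳ {S u} e))
      ; E⊆S  = λ u w e → ∧-true⁻ˡ e
      }
      where
      E-sym : ∀ u w → S u ∧ (S w ∧ colourAdj i u w) ≡ S w ∧ (S u ∧ colourAdj i w u)
      E-sym u w rewrite colourAdj-sym csym i u w = ∧-swapˡ (S u) (S w) (colourAdj i w u)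
    mono : Mono c i H
    mono u w e = ≟-true (∧-true⁻ʳ {adj G u w} (∧-true⁻ʳ {S w} (∧-true⁻ʳ {S u} e)))
    minDeg : SubMinDeg H d
    minDeg v v∈S rewrite countTrue-guard (S v) (S ∩ colourAdj i v) | v∈S = dense v v∈S

  monoSub-order : ∀ (H : Subgraph G) {i d} → Mono c i H → SubMinDeg H d → (P : Fin n → Bool) →
    (∀ v → v ∈ P → countTrue (colourAdj i v) < d) → order H ≤ n ∸ countTrue P
  monoSub-order H {i} mono minDeg P sparse =
    ≤-trans (countTrue-mono S⊆∁P) (≤-reflexive (countTrue-∁≡∸ P))
    where
    E⊆colourAdj : ∀ v → E H v ⊆ colourAdj i v
    E⊆colourAdj v w e = ∧-true⁺ (E⊆G H v w e) (dec-true (c v w ≟ i) (mono v w e))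
    S⊆∁P : S H ⊆ ∁ P
    S⊆∁P v v∈S with P v in v∈P
    ... | false = refl
    ... | true  = ⊥-elim (<⇒≱ (sparse v v∈P) (≤-trans (minDeg v v∈S) (countTrue-mono (E⊆colourAdj v))))

red blue : Fin 2
red  = zero
blue = suc zero

module TwoColourLowerBound (G : Graph n) (c : Colouring n 2) (csym : SymColouring c) (d′ k′ : ℕ)
                           (δ≥ : MinDegAtLeast G (n ∸ suc k′)) where

  open ColourClasses G c

  s m : ℕ
  s = d′ + d′ + k′
  m = suc s

  open module Peel (i : Fin 2) = Peeling (colourAdj i) (suc d′)

  colour-cases : ∀ v w → w ∈ colourAdj red v ⊎ w ∈ colourAdj blue v ⊎ w ∈ ∁ (adj G v)
  colour-cases v w with adj G v w | c v w
  ... | true  | zero     = inj₁ refl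
  ... | true  | suc zero = inj₂ (inj₁ refl)
  ... | false | _        = inj₂ (inj₂ refl)

  adj⊆red⊎blue : ∀ v w → w ∈ adj G v → w ∈ colourAdj red v ⊎ w ∈ colourAdj blue v
  adj⊆red⊎blue v w e with colour-cases v w
  ... | inj₁ isRed           = inj₁ isRed
  ... | inj₂ (inj₁ isBlue)   = inj₂ isBlue
  ... | inj₂ (inj₂ nonadj)   = ⊥-elim (true≢false e (not-true⁻ nonadj))

  module _ (large : (suc d′ + m) + (suc d′ + m) ≤ n ∸ suc k′)
           {A B} (|A| : countTrue A ≡ m) (A-peelable : Peelable red A)
                 (|B| : countTrue B ≡ m) (B-peelable : Peelable blue B) where

    B⊆∁A : B ⊆ ∁ A
    B⊆∁A v v∈B with A v in v∈A
    ... | false = refl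
    ... | true  = ⊥-elim (<⇒≱ degree< (≤-trans large (δ≥ v)))
      where
      open ≤-Reasoning
      degree< : countTrue (adj G v) < (suc d′ + m) + (suc d′ + m)
      degree< = begin-strict
        countTrue (adj G v)
          ≤⟨ countTrue-cover (adj⊆red⊎blue v) ⟩
        countTrue (colourAdj red v) + countTrue (colourAdj blue v)
          <⟨ +-mono-< (peelable-degree red A-peelable v v∈A) (peelable-degree blue B-peelable v v∈B) ⟩
        (suc d′ + countTrue A) + (suc d′ + countTrue B)
          ≡⟨ cong₂ (λ x y → (suc d′ + x) + (suc d′ + y)) |A| |B| ⟩
        (suc d′ + m) + (suc d′ + m) ∎

    blue-from-A : ∀ a → a ∈ A → suc d′ ≤ countTrue (B ∩ colourAdj blue a)
    blue-from-A a a∈A = +-cancelʳ-≤ (d′ + k′) (suc d′) _ (begin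
      suc d′ + (d′ + k′)                  ≡⟨ cong suc (sym (+-assoc d′ d′ k′)) ⟩
      m                                   ≡⟨ sym |B| ⟩
      countTrue B                         ≤⟨ countTrue-cover₃ split ⟩
      countTrue (B ∩ colourAdj blue a) + (countTrue (B ∩ colourAdj red a) + countTrue (B ∩ ∁ (adj G a)))
        ≤⟨ +-monoʳ-≤ (countTrue (B ∩ colourAdj blue a)) (+-mono-≤ red≤ nonadj≤) ⟩
      countTrue (B ∩ colourAdj blue a) + (d′ + k′) ∎)
      where
      open ≤-Reasoning
      a∉B : a ∉ B
      a∉B = not-true⁻ (⊆∁-sym B⊆∁A a a∈A)
      split : ∀ w → w ∈ B → w ∈ B ∩ colourAdj blue a ⊎ w ∈ B ∩ colourAdj red a ⊎ w ∈ B ∩ ∁ (adj G a)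
      split w w∈B with colour-cases a w
      ... | inj₁ isRed         = inj₂ (inj₁ (∧-true⁺ w∈B isRed))
      ... | inj₂ (inj₁ isBlue) = inj₁ (∧-true⁺ w∈B isBlue)
      ... | inj₂ (inj₂ nonadj) = inj₂ (inj₂ (∧-true⁺ w∈B nonadj))
      red≤ : countTrue (B ∩ colourAdj red a) ≤ d′
      red≤ = ≤-pred (peelable-degreeIn red A-peelable a a∈A B⊆∁A)
      nonadj≤ : countTrue (B ∩ ∁ (adj G a)) ≤ k′
      nonadj≤ = ≤-pred (begin
        suc (countTrue (B ∩ ∁ (adj G a)))          ≡⟨ sym (countTrue-insert (B ∩ ∁ (adj G a)) (cong (_∧ _) a∉B)) ⟩
        countTrue ((B ∩ ∁ (adj G a)) ∪ ｛ a ｝)    ≤⟨ countTrue-mono ⊆nonNeighbours ⟩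
        countTrue (∁ (adj G a))                    ≤⟨ ≤countTrue⇒countTrue∁≤ (adj G a) (δ≥ a) ⟩
        suc k′                                     ∎)
        where
        ⊆nonNeighbours : (B ∩ ∁ (adj G a)) ∪ ｛ a ｝ ⊆ ∁ (adj G a)
        ⊆nonNeighbours w e with ∨-true⁻ e
        ... | inj₁ w∈B∖N = ∧-true⁻ʳ {B w} w∈B∖N
        ... | inj₂ w∈｛a｝ = subst (λ u → u ∈ ∁ (adj G a)) (sym (≟-true w∈｛a｝)) (cong not (Graph.irrfl G a))

    blue-from-B : ∀ b → b ∈ B → countTrue (A ∩ flip (colourAdj blue) b) ≤ d′
    blue-from-B b b∈B = ≤-pred (begin-strict
      countTrue (A ∩ flip (colourAdj blue) b) ≡⟨ countTrue-cong (λ a → cong (A a ∧_) (colourAdj-sym csym blue a b)) ⟩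
      countTrue (A ∩ colourAdj blue b)        <⟨ peelable-degreeIn blue B-peelable b b∈B (⊆∁-sym B⊆∁A) ⟩
      suc d′                                  ∎)
      where open ≤-Reasoning

    no-peelable-pair : ⊥
    no-peelable-pair = 1+n≰n (*-cancelˡ-≤ m (begin
      m * suc d′           ≡⟨ cong (_* suc d′) (sym |A|) ⟩
      countTrue A * suc d′ ≤⟨ double-counting A B (colourAdj blue) (suc d′) d′ blue-from-A blue-from-B ⟩
      countTrue B * d′     ≡⟨ cong (_* d′) |B| ⟩
      m * d′               ∎))
      where open ≤-Reasoning

  lower-bound : (suc d′ + m) + (suc d′ + m) ≤ n ∸ suc k′ → HasMonoSub G c (suc d′) (n ∸ s)
  lower-bound large with peel red s | peel blue s
  ... | inj₁ core | _         = core⇒monoSub csym red core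
  ... | inj₂ _    | inj₁ core = core⇒monoSub csym blue core
  ... | inj₂ (A , |A| , A-peelable) | inj₂ (B , |B| , B-peelable) =
    ⊥-elim (no-peelable-pair large |A| A-peelable |B| B-peelable)

module Construction (n d′ k′ : ℕ) where

  s : ℕ
  s = d′ + d′ + k′

  wrap : ℕ → ℕ
  wrap t = if t <ᵇ s then t else t ∸ s

  wrap-< : ∀ {t} → t < s + s → wrap t < s
  wrap-< {t} t<2s with t <ᵇ s in t<s
  ... | true  = <ᵇ-true⇒< {y = s} t<s
  ... | false = subst (t ∸ s <_) (m+n∸m≡n s s) (∸-monoˡ-< t<2s (<ᵇ-false⇒≥ {y = s} t<s))

  wrap-injective : ∀ {a t u} → a ≤ t → t < a + s → a ≤ u → u < a + s → wrap t ≡ wrap u → t ≡ u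
  wrap-injective {a} {t} {u} a≤t t<a+s a≤u u<a+s eq with t <ᵇ s in t<s | u <ᵇ s in u<s
  ... | true  | true  = eq
  ... | false | false = ∸-cancelʳ-≡ (<ᵇ-false⇒≥ {y = s} t<s) (<ᵇ-false⇒≥ {y = s} u<s) eq
  ... | true  | false = ⊥-elim (<⇒≱ u<a+s (begin
    a + s       ≤⟨ +-monoˡ-≤ s a≤t ⟩
    t + s       ≡⟨ cong (_+ s) eq ⟩
    u ∸ s + s   ≡⟨ m∸n+n≡m (<ᵇ-false⇒≥ {y = s} u<s) ⟩
    u           ∎))
    where open ≤-Reasoning
  ... | false | true  = ⊥-elim (<⇒≱ t<a+s (begin
    a + s       ≤⟨ +-monoˡ-≤ s a≤u ⟩
    u + s       ≡⟨ cong (_+ s) (sym eq) ⟩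
    t ∸ s + s   ≡⟨ m∸n+n≡m (<ᵇ-false⇒≥ {y = s} t<s) ⟩
    t           ∎))
    where open ≤-Reasoning

  -- For x < s ≤ y this is (x + (y − s)) mod s, written symmetrically in x and y.
  label : ℕ → ℕ → ℕ
  label x y = wrap (x + y ∸ s)

  label-comm : ∀ x y → label x y ≡ label y x
  label-comm x y = cong (λ t → wrap (t ∸ s)) (+-comm x y)

  label-< : ∀ {x y} → x < s → s ≤ y → y < s + s → label x y < s
  label-< {x} {y} x<s s≤y y<2s = wrap-< (begin-strict
    x + y ∸ s   ≡⟨ +-∸-assoc x s≤y ⟩
    x + (y ∸ s) <⟨ +-mono-< x<s (subst (y ∸ s <_) (m+n∸m≡n s s) (∸-monoˡ-< y<2s s≤y)) ⟩
    s + s       ∎)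
    where open ≤-Reasoning

  label-injective : ∀ {a x y₁ y₂} → s ≤ x + a → a ≤ y₁ → y₁ < a + s → a ≤ y₂ → y₂ < a + s →
    label x y₁ ≡ label x y₂ → y₁ ≡ y₂
  label-injective {a} {x} {y₁} {y₂} s≤x+a a≤y₁ y₁<a+s a≤y₂ y₂<a+s eq =
    +-cancelˡ-≡ x y₁ y₂ (∸-cancelʳ-≡ (s≤x+ a≤y₁) (s≤x+ a≤y₂)
      (wrap-injective (lower a≤y₁) (upper a≤y₁ y₁<a+s) (lower a≤y₂) (upper a≤y₂ y₂<a+s) eq))
    where
    open ≤-Reasoning
    s≤x+ : ∀ {y} → a ≤ y → s ≤ x + y
    s≤x+ a≤y = ≤-trans s≤x+a (+-monoʳ-≤ x a≤y)
    lower : ∀ {y} → a ≤ y → x + a ∸ s ≤ x + y ∸ s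
    lower a≤y = ∸-monoˡ-≤ s (+-monoʳ-≤ x a≤y)
    upper : ∀ {y} → a ≤ y → y < a + s → x + y ∸ s < x + a ∸ s + s
    upper {y} a≤y y<a+s = begin-strict
      x + y ∸ s       <⟨ ∸-monoˡ-< (+-monoʳ-< x y<a+s) (s≤x+ a≤y) ⟩
      x + (a + s) ∸ s ≡⟨ cong (_∸ s) (sym (+-assoc x a s)) ⟩
      x + a + s ∸ s   ≡⟨ m+n∸n≡m (x + a) s ⟩
      x + a           ≡⟨ sym (m∸n+n≡m s≤x+a) ⟩
      x + a ∸ s + s   ∎

  data Part : Set where
    partA partB partC : Part

  part : ℕ → Part
  part x = if x <ᵇ s then partA else if x <ᵇ s + s then partB else partC

  part≡A⇒ : ∀ x → part x ≡ partA → x < s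
  part≡A⇒ x e with x <ᵇ s in x<s | x <ᵇ s + s
  ... | true  | _     = <ᵇ-true⇒< x<s
  part≡A⇒ x () | false | true
  part≡A⇒ x () | false | false

  part≡B⇒ : ∀ x → part x ≡ partB → s ≤ x × x < s + s
  part≡B⇒ x e with x <ᵇ s in x<s | x <ᵇ s + s in x<2s
  part≡B⇒ x () | true | _
  ... | false | true  = <ᵇ-false⇒≥ x<s , <ᵇ-true⇒< x<2s
  part≡B⇒ x () | false | false

  <s⇒part≡A : ∀ {x} → x < s → part x ≡ partA
  <s⇒part≡A x<s rewrite T⇒≡true (<⇒<ᵇ x<s) = refl

  ⇒part≡B : ∀ {x} → s ≤ x → x < s + s → part x ≡ partB
  ⇒part≡B {x} s≤x x<2s rewrite <ᵇ-false⁺ s≤x | T⇒≡true (<⇒<ᵇ x<2s) = refl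

  noEdge : Part → Part → ℕ → Bool
  noEdge partA partB ℓ = d′ + d′ ≤ᵇ ℓ
  noEdge partB partA ℓ = d′ + d′ ≤ᵇ ℓ
  noEdge _     _     _ = false

  colourOf : Part → Part → ℕ → Fin 2
  colourOf partA partB ℓ = if ℓ <ᵇ d′ then red else blue
  colourOf partB partA ℓ = if ℓ <ᵇ d′ then red else blue
  colourOf partA _     _ = blue
  colourOf _     partA _ = blue
  colourOf _     _     _ = red

  noEdge-comm : ∀ a b ℓ → noEdge a b ℓ ≡ noEdge b a ℓ
  noEdge-comm partA partA ℓ = refl
  noEdge-comm partA partB ℓ = refl
  noEdge-comm partA partC ℓ = refl
  noEdge-comm partB partA ℓ = refl
  noEdge-comm partB partB ℓ = refl
  noEdge-comm partB partC ℓ = refl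
  noEdge-comm partC partA ℓ = refl
  noEdge-comm partC partB ℓ = refl
  noEdge-comm partC partC ℓ = refl

  colourOf-comm : ∀ a b ℓ → colourOf a b ℓ ≡ colourOf b a ℓ
  colourOf-comm partA partA ℓ = refl
  colourOf-comm partA partB ℓ = refl
  colourOf-comm partA partC ℓ = refl
  colourOf-comm partB partA ℓ = refl
  colourOf-comm partB partB ℓ = refl
  colourOf-comm partB partC ℓ = refl
  colourOf-comm partC partA ℓ = refl
  colourOf-comm partC partB ℓ = refl
  colourOf-comm partC partC ℓ = refl

  partOf : Fin n → Part
  partOf v = part (toℕ v)

  labelOf : Fin n → Fin n → ℕ
  labelOf u w = label (toℕ u) (toℕ w)

  nonNeighbour : Fin n → Fin n → Bool
  nonNeighbour u w = noEdge (partOf u) (partOf w) (labelOf u w)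

  nonNeighbour-sym : ∀ u w → nonNeighbour u w ≡ nonNeighbour w u
  nonNeighbour-sym u w = trans (noEdge-comm (partOf u) (partOf w) _)
                               (cong (noEdge (partOf w) (partOf u)) (label-comm (toℕ u) (toℕ w)))

  G : Graph n
  G = record
    { adj   = λ u w → not (does (u ≟ w) ∨ nonNeighbour u w)
    ; sym   = λ u w → cong₂ (λ a b → not (a ∨ b)) (≟-sym u w) (nonNeighbour-sym u w)
    ; irrfl = λ v → cong (λ a → not (a ∨ nonNeighbour v v)) (dec-true (v ≟ v) refl)
    }

  c : Colouring n 2
  c u w = colourOf (partOf u) (partOf w) (labelOf u w)

  c-sym : SymColouring c
  c-sym u w = trans (colourOf-comm (partOf u) (partOf w) _)
                    (cong (colourOf (partOf w) (partOf u)) (label-comm (toℕ u) (toℕ w)))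

  noEdge-A : ∀ b ℓ → noEdge partA b ℓ ≡ true → b ≡ partB × d′ + d′ ≤ ℓ
  noEdge-A partB ℓ e = refl , ≤ᵇ-true⇒≤ e

  noEdge-B : ∀ b ℓ → noEdge partB b ℓ ≡ true → b ≡ partA × d′ + d′ ≤ ℓ
  noEdge-B partA ℓ e = refl , ≤ᵇ-true⇒≤ e

  noEdge-C : ∀ b ℓ → noEdge partC b ℓ ≡ false
  noEdge-C partA ℓ = refl
  noEdge-C partB ℓ = refl
  noEdge-C partC ℓ = refl

  red-A : ∀ b ℓ → colourOf partA b ℓ ≡ red → b ≡ partB × ℓ < d′
  red-A partA ℓ ()
  red-A partB ℓ e with ℓ <ᵇ d′ in ℓ<d′
  ... | true = refl , <ᵇ-true⇒< ℓ<d′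
  red-A partB ℓ () | false
  red-A partC ℓ ()

  blue-B : ∀ b ℓ → colourOf partB b ℓ ≡ blue → noEdge partB b ℓ ≡ false →
    b ≡ partA × d′ ≤ ℓ × ℓ < d′ + d′
  blue-B partA ℓ e edge with ℓ <ᵇ d′ in ℓ<d′
  blue-B partA ℓ () edge | true
  ... | false = refl , <ᵇ-false⇒≥ ℓ<d′ , ≤ᵇ-false⇒> edge
  blue-B partB ℓ () edge
  blue-B partC ℓ () edge

  count-by-label : ∀ (v : Fin n) {a} (p : Fin n → Bool) L U → s ≤ a + toℕ v →
    (∀ w → w ∈ p → (a ≤ toℕ w × toℕ w < a + s) × L ≤ labelOf v w × labelOf v w < U) →
    countTrue p ≤ U ∸ L
  count-by-label v {a} p L U s≤a+v range =
    countTrue-injective (labelOf v) inj L U (λ w e → proj₂ (range w e))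
    where
    inj : Injective-on p (labelOf v)
    inj i j pᵢ pⱼ eq with range i pᵢ | range j pⱼ
    ... | (a≤i , i<a+s) , _ | (a≤j , j<a+s) , _ =
      toℕ-injective (label-injective (subst (s ≤_) (+-comm a (toℕ v)) s≤a+v) a≤i i<a+s a≤j j<a+s eq)

  open ColourClasses G c

  nonNeighbour-≤ : ∀ v → countTrue (nonNeighbour v) ≤ k′
  nonNeighbour-≤ v = byPart (partOf v) refl
    where
    byPart : ∀ a → partOf v ≡ a → countTrue (nonNeighbour v) ≤ k′
    byPart partA v-part = ≤-trans (count-by-label v (nonNeighbour v) (d′ + d′) s (m≤m+n s (toℕ v)) range)
                          (≤-reflexive (m+n∸m≡n (d′ + d′) k′))
      where
      range : ∀ w → w ∈ nonNeighbour v → (s ≤ toℕ w × toℕ w < s + s) × d′ + d′ ≤ labelOf v w × labelOf v w < s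
      range w e with noEdge-A (partOf w) _ (subst (λ a → noEdge a (partOf w) (labelOf v w) ≡ true) v-part e)
      ... | w-part , 2d′≤ℓ with part≡B⇒ _ w-part
      ...   | s≤w , w<2s = (s≤w , w<2s) , 2d′≤ℓ , label-< (part≡A⇒ _ v-part) s≤w w<2s
    byPart partB v-part = ≤-trans (count-by-label v {0} (nonNeighbour v) (d′ + d′) s s≤v range)
                          (≤-reflexive (m+n∸m≡n (d′ + d′) k′))
      where
      s≤v : s ≤ toℕ v
      s≤v = proj₁ (part≡B⇒ _ v-part)
      range : ∀ w → w ∈ nonNeighbour v → (0 ≤ toℕ w × toℕ w < s) × d′ + d′ ≤ labelOf v w × labelOf v w < s
      range w e with noEdge-B (partOf w) _ (subst (λ a → noEdge a (partOf w) (labelOf v w) ≡ true) v-part e)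
      ... | w-part , 2d′≤ℓ = (z≤n , part≡A⇒ _ w-part) , 2d′≤ℓ ,
            subst (_< s) (label-comm (toℕ w) (toℕ v)) (label-< (part≡A⇒ _ w-part) s≤v (proj₂ (part≡B⇒ _ v-part)))
    byPart partC v-part = ≤-trans (≤-reflexive (countTrue-none (nonNeighbour v) none)) z≤n
      where
      none : ∀ w → w ∉ nonNeighbour v
      none w = subst (λ a → noEdge a (partOf w) (labelOf v w) ≡ false) (sym v-part) (noEdge-C (partOf w) (labelOf v w))

  red-degree : ∀ v → partOf v ≡ partA → countTrue (colourAdj red v) ≤ d′
  red-degree v v-part = count-by-label v (colourAdj red v) 0 d′ (m≤m+n s (toℕ v)) range
    where
    range : ∀ w → w ∈ colourAdj red v → (s ≤ toℕ w × toℕ w < s + s) × 0 ≤ labelOf v w × labelOf v w < d′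
    range w e with red-A (partOf w) _ (subst (λ a → colourOf a (partOf w) (labelOf v w) ≡ red) v-part
                                               (≟-true (∧-true⁻ʳ {adj G v w} e)))
    ... | w-part , ℓ<d′ = part≡B⇒ _ w-part , z≤n , ℓ<d′

  adj⇒¬nonNeighbour : ∀ v w → w ∈ adj G v → nonNeighbour v w ≡ false
  adj⇒¬nonNeighbour v w e = ∨-conicalʳ (does (v ≟ w)) (nonNeighbour v w) (not-true⁻ e)

  blue-degree : ∀ v → partOf v ≡ partB → countTrue (colourAdj blue v) ≤ d′
  blue-degree v v-part = ≤-trans (count-by-label v {0} (colourAdj blue v) d′ (d′ + d′) s≤v range)
                                 (≤-reflexive (m+n∸m≡n d′ d′))
    where
    s≤v : s ≤ toℕ v
    s≤v = proj₁ (part≡B⇒ _ v-part)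
    range : ∀ w → w ∈ colourAdj blue v → (0 ≤ toℕ w × toℕ w < s) × d′ ≤ labelOf v w × labelOf v w < d′ + d′
    range w e with blue-B (partOf w) _
                     (subst (λ a → colourOf a (partOf w) (labelOf v w) ≡ blue) v-part (≟-true (∧-true⁻ʳ {adj G v w} e)))
                     (subst (λ a → noEdge a (partOf w) (labelOf v w) ≡ false) v-part (adj⇒¬nonNeighbour v w (∧-true⁻ˡ e)))
    ... | w-part , d′≤ℓ , ℓ<2d′ = (z≤n , part≡A⇒ _ w-part) , d′≤ℓ , ℓ<2d′

  G-min-degree : MinDegAtLeast G (n ∸ suc k′)
  G-min-degree v = countTrue∁≤⇒≤countTrue (adj G v)
    (≤-trans (countTrue-cover split) (+-mono-≤ (countTrue-≤1 unique) (nonNeighbour-≤ v)))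
    where
    split : ∀ w → w ∈ ∁ (adj G v) → does (v ≟ w) ≡ true ⊎ w ∈ nonNeighbour v
    split w e = ∨-true⁻ (trans (sym (not-involutive _)) e)
    unique : ∀ i j → does (v ≟ i) ≡ true → does (v ≟ j) ≡ true → i ≡ j
    unique i j v≡i v≡j = trans (sym (≟-true {x = v} v≡i)) (≟-true {x = v} v≡j)

  module _ (2s≤n : s + s ≤ n) where

    inA inB : Fin n → Bool
    inA v = toℕ v <ᵇ s
    inB v = (s ≤ᵇ toℕ v) ∧ (toℕ v <ᵇ s + s)

    s≤|inA| : s ≤ countTrue inA
    s≤|inA| = countTrue-interval 0 s (≤-trans (m≤m+n s s) 2s≤n) (λ v _ v<s → T⇒≡true (<⇒<ᵇ v<s))

    s≤|inB| : s ≤ countTrue inB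
    s≤|inB| = subst (_≤ countTrue inB) (m+n∸m≡n s s)
      (countTrue-interval s (s + s) 2s≤n
        (λ v s≤v v<2s → ∧-true⁺ (T⇒≡true (≤⇒≤ᵇ s≤v)) (T⇒≡true (<⇒<ᵇ v<2s))))

    upper-bound : ∀ i (H : Subgraph G) → Mono c i H → SubMinDeg H (suc d′) → order H ≤ n ∸ s
    upper-bound zero H mono minDeg = ≤-trans (monoSub-order H mono minDeg inA sparse) (∸-monoʳ-≤ n s≤|inA|)
      where
      sparse : ∀ v → v ∈ inA → countTrue (colourAdj red v) < suc d′
      sparse v e = s≤s (red-degree v (<s⇒part≡A (<ᵇ-true⇒< e)))
    upper-bound (suc zero) H mono minDeg = ≤-trans (monoSub-order H mono minDeg inB sparse) (∸-monoʳ-≤ n s≤|inB|)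
      where
      sparse : ∀ v → v ∈ inB → countTrue (colourAdj blue v) < suc d′
      sparse v e =
        s≤s (blue-degree v (⇒part≡B (≤ᵇ-true⇒≤ (∧-true⁻ˡ e)) (<ᵇ-true⇒< (∧-true⁻ʳ {s ≤ᵇ toℕ v} e))))

theorem3 : (d k : ℕ) → 1 ≤ d → 1 ≤ k →
    Σ ℕ λ N → (n : ℕ) → N ≤ n →
      fEquals n (n ∸ k) d 2 (n + 3 ∸ (2 * d + k))
theorem3 (suc d′) (suc k′) _ _ = N , λ n N≤n → subst (fEquals n (n ∸ suc k′) (suc d′) 2) (sym (target n))
  ( (λ G δ≥ c c-sym → TwoColourLowerBound.lower-bound G c c-sym d′ k′ δ≥ (large N≤n))
  , ( Construction.G n d′ k′ , Construction.G-min-degree n d′ k′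
    , Construction.c n d′ k′ , Construction.c-sym n d′ k′
    , Construction.upper-bound n d′ k′ (2s≤n N≤n)))
  where
  s degreeBound N : ℕ
  s = d′ + d′ + k′
  degreeBound = suc d′ + suc s
  N = degreeBound + degreeBound + suc k′

  target : ∀ n → n + 3 ∸ (2 * suc d′ + suc k′) ≡ n ∸ s
  target n = trans (cong₂ _∸_ (+-comm n 3) (3+s d′ k′)) ([m+n]∸[m+o]≡n∸o 3 n s)
    where
    3+s : ∀ x y → 2 * suc x + suc y ≡ 3 + (x + x + y)
    3+s = solve-∀

  large : ∀ {n} → N ≤ n → degreeBound + degreeBound ≤ n ∸ suc k′
  large {n} N≤n = subst (_≤ n ∸ suc k′) (m+n∸n≡m _ (suc k′)) (∸-monoˡ-≤ (suc k′) N≤n)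

  2s≤n : ∀ {n} → N ≤ n → s + s ≤ n
  2s≤n N≤n = ≤-trans (+-mono-≤ s≤bound s≤bound) (≤-trans (m≤m+n _ (suc k′)) N≤n)
    where
    s≤bound : s ≤ degreeBound
    s≤bound = ≤-trans (n≤1+n s) (m≤n+m (suc s) (suc d′))
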